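{- Let $G=(V,E)$ be an undirected unweighted graph, let $P$ be a set of $p$ ordered node pairs, and let $\pi$ be a shortest path tiebreaking scheme that is lazy for $P$. Then $\left|\bigcup_{s\in V}\mathcal{B}(T_s)\right|=O(p)$, with an absolute implied constant.
   Context: A shortest path tiebreaking scheme maps each ordered pair $(s,t)$ to a shortest $s$–$t$ path in $G$; $\pi(Q)$ is the union of the edge sets of $\pi(q)$, $q\in Q$. $P_s=\{(s,t)\in P\}$ (pairs are ordered, so each pair lies in exactly one $P_s$) and $T_s=(V,\pi(P_s))$. In a tree rooted at $s$ with edges oriented away from $s$, a branching node has out-degree at least 2, branching edges are those leaving branching nodes, and $\mathcal{B}(T)$ is the set of branching edges. $\pi$ is lazy for $P$ if (1) each $T_s$ is a tree rooted at $s$ (possibly plus isolated nodes) and (2) for all $s$ and distinct edges $(x,y),(x',y')\in T_s\setminus\mathcal{B}(T_s)$ with $\mathrm{dist}_G(s,y)=\mathrm{dist}_G(s,y')=\mathrm{dist}_G(s,x)+1=\mathrm{dist}_G(s,x')+1$, $(x,y')\notin E$ and $(x',y)\notin E$. -}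

module Defs where

open import Data.Nat using (ℕ; zero; suc; _≤_; _*_)
open import Data.Fin using (Fin)
open import Data.Product using (Σ; ∃; _×_; _,_; proj₁; proj₂)
open import Data.Sum using (_⊎_)
open import Data.List using (List; []; _∷_; _++_; length)
open import Data.List.Relation.Unary.Unique.Propositional using (Unique)
open import Data.Empty using (⊥)
open import Relation.Nullary using (¬_)
open import Relation.Binary.PropositionalEquality using (_≡_; _≢_)
open import Function.Definitions using (Injective)

record Graph (n : ℕ) : Set₁ where
  field
    Adj   : Fin n → Fin n → Set
    sym   : ∀ {x y} → Adj x y → Adj y x
    irrefl : ∀ {x} → ¬ Adj x x

module _ {n : ℕ} where

  V : Set
  V = Fin n

  -- WalkL R u v l : l is the vertex list of a walk from u to v along R
  -- (consecutive vertices are R-related). It has (length l - 1) edges.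
  data WalkL (R : V → V → Set) : V → V → List V → Set where
    stop : ∀ {u} → WalkL R u u (u ∷ [])
    step : ∀ {u w v l} → R u w → WalkL R w v l → WalkL R u v (u ∷ l)

  -- dist_G(s,t) = d  (d edges on a shortest walk)
  IsDist : (R : V → V → Set) → V → V → ℕ → Set
  IsDist R s t d =
    (∃ λ l → WalkL R s t l × length l ≡ suc d)
    × (∀ l → WalkL R s t l → suc d ≤ length l)

  ShortestPath : (R : V → V → Set) → V → V → List V → Set
  ShortestPath R s t l = WalkL R s t l × (∀ l' → WalkL R s t l' → length l ≤ length l')

  data Consec : List V → V → V → Set where
    here  : ∀ {x y l} → Consec (x ∷ y ∷ l) x y
    there : ∀ {z x y l} → Consec l x y → Consec (z ∷ l) x y

  SimplePath : (R : V → V → Set) → V → V → List V → Set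
  SimplePath R u v l = WalkL R u v l × Unique l

-- Shortest path tiebreaking scheme restricted to a set P of p ordered pairs,
-- P given as an injective map Fin p → V × V; π i is a shortest path for P i.
module Scheme {n : ℕ} (G : Graph n) {p : ℕ}
              (P : Fin p → Fin n × Fin n)
              (π : (i : Fin p) → Σ (List (Fin n)) (ShortestPath (Graph.Adj G) (proj₁ (P i)) (proj₂ (P i)))) where

  open Graph G

  -- undirected edge set π(P_s) of T_s = (V, π(P_s))
  TEdge : Fin n → Fin n → Fin n → Set
  TEdge s x y = ∃ λ (i : Fin p) → proj₁ (P i) ≡ s ×
                  (Consec (proj₁ (π i)) x y ⊎ Consec (proj₁ (π i)) y x)

  InTree : Fin n → Fin n → Set
  InTree s u = u ≡ s ⊎ ∃ λ w → TEdge s u w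

  -- T_s is a tree rooted at s plus isolated nodes: between any two
  -- non-isolated nodes (s included) there is exactly one simple path.
  IsTreeAt : Fin n → Set
  IsTreeAt s = ∀ u v → InTree s u → InTree s v →
               Σ (List (Fin n)) λ l → SimplePath (TEdge s) u v l ×
                 (∀ l' → SimplePath (TEdge s) u v l' → l' ≡ l)

  -- (x , y) is an edge of T_s oriented away from s: x immediately
  -- precedes y on the (tree) path from s to y.
  Oriented : Fin n → Fin n → Fin n → Set
  Oriented s x y = ∃ λ l → SimplePath (TEdge s) s y (l ++ x ∷ y ∷ [])

  Branching : Fin n → Fin n → Set
  Branching s x = ∃ λ y → ∃ λ y' → y ≢ y' × Oriented s x y × Oriented s x y'

  BranchingEdge : Fin n → Fin n → Fin n → Set
  BranchingEdge s x y = Oriented s x y × Branching s x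

  NonBranchingEdge : Fin n → Fin n → Fin n → Set
  NonBranchingEdge s x y = Oriented s x y × ¬ Branching s x

  Lazy : Set
  Lazy = (∀ s → IsTreeAt s)
       × (∀ s x y x' y' → NonBranchingEdge s x y → NonBranchingEdge s x' y' →
            (x , y) ≢ (x' , y') →
            ∀ d → IsDist Adj s x d → IsDist Adj s x' d →
                  IsDist Adj s y (suc d) → IsDist Adj s y' (suc d) →
            ¬ Adj x y' × ¬ Adj x' y)

  InBranchUnion : Fin n × Fin n → Set
  InBranchUnion (x , y) = ∃ λ s → BranchingEdge s x y ⊎ BranchingEdge s y x

SameEdge : {n : ℕ} → Fin n × Fin n → Fin n × Fin n → Set
SameEdge (x , y) (x' , y') = (x ≡ x' × y ≡ y') ⊎ (x ≡ y' × y ≡ x')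

module Submission where

-- Proof by charging.  Order the pairs by index.  An edge x → y of T_s is
-- first used by π_j if π_j is the earliest pair with source s traversing it;
-- it diverges at j if an earlier pair with source s leaves x along another edge.
--   (a) Two paths of T_s through x agree up to x (tree paths are unique).
--   (b) By (a), each π_j has at most one first-used divergent edge.
--   (c) For each x, at most one out-edge of x in T_s is first used without
--       diverging (the one used earliest).
-- A branching edge x → y that diverges at its first use j is charged to the
-- token inj₁ j; otherwise x has a sibling edge x → z first used later, by
-- some j', where it diverges, and x → y is charged to inj₂ j'.  By (b) and
-- (c) every one of the 2p tokens is charged by at most one edge, and a
-- pigeonhole count bounds any list of distinct branching edges by 2p.

open import Defs
open import Data.Nat using (ℕ; _≤_; _*_)
open import Data.Fin using (Fin)
open import Data.Product using (Σ; ∃; _×_; proj₁; proj₂)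
open import Data.List using (List; length)
open import Data.List.Relation.Unary.All using (All)
open import Data.List.Relation.Unary.AllPairs using (AllPairs)
open import Relation.Nullary using (¬_)
open import Function.Definitions using (Injective)
open import Relation.Binary.PropositionalEquality using (_≡_)

import Data.Nat as ℕ
import Data.Nat.Properties as ℕ
import Data.Fin as Fin
import Data.Fin.Properties as Fin
open import Data.Fin using (zero; suc)
open import Data.Product using (_,_)
open import Data.Sum using (_⊎_; inj₁; inj₂)
open import Data.List using ([]; _∷_; _++_; lookup)
open import Data.List.Properties using (++-assoc; ∷ʳ-injectiveˡ; ∷-injective)
open import Data.List.Relation.Unary.All using ([]; _∷_)
open import Data.List.Relation.Unary.AllPairs using ([]; _∷_)
open import Data.List.Relation.Unary.Any using (here; there)
import Data.List.Relation.Unary.All.Properties as All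
open import Data.List.Relation.Unary.Unique.Propositional using (Unique)
open import Data.List.Membership.Propositional using (_∈_)
open import Data.Empty using (⊥-elim)
open import Relation.Nullary using (Dec; yes; no)
open import Relation.Nullary.Decidable using (_×-dec_; ¬?)
open import Relation.Binary.PropositionalEquality using (_≢_; refl; sym; trans; cong; subst)
open import Relation.Binary.Definitions using (tri<; tri≈; tri>)

module Paths {n : ℕ} where

  walk-consec : ∀ {R : Fin n → Fin n → Set} {u v l x y} →
                WalkL R u v l → Consec l x y → R x y
  walk-consec (step r stop) here = r
  walk-consec (step r (step _ _)) here = r
  walk-consec (step _ w) (there c) = walk-consec w c

  walk-retarget : ∀ {R R' : Fin n → Fin n → Set} {u v l} → WalkL R u v l →
                  (∀ {x y} → Consec l x y → R' x y) → WalkL R' u v l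
  walk-retarget stop f = stop
  walk-retarget (step r stop) f = step (f here) stop
  walk-retarget (step r (step r' w)) f =
    step (f here) (walk-retarget (step r' w) (λ c → f (there c)))

  walk-prefix : ∀ {R : Fin n → Fin n → Set} {u v} c {x d} →
                WalkL R u v (c ++ x ∷ d) → WalkL R u x (c ++ x ∷ [])
  walk-prefix [] stop = stop
  walk-prefix [] (step r w) = stop
  walk-prefix (z ∷ []) (step r w) = step r (walk-prefix [] w)
  walk-prefix (z ∷ z' ∷ c) (step r w) = step r (walk-prefix (z' ∷ c) w)

  walk-from : ∀ {R : Fin n → Fin n → Set} {w v l u} → WalkL R w v l → u ∈ l →
              Σ (List (Fin n)) λ l' → WalkL R u v l' × length l' ≤ length l
  walk-from stop (here refl) = _ , stop , ℕ.≤-refl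
  walk-from (step r w) (here refl) = _ , step r w , ℕ.≤-refl
  walk-from (step r w) (there m) with walk-from w m
  ... | l' , w' , le = l' , w' , ℕ.m≤n⇒m≤1+n le

  walk-end : ∀ {R : Fin n → Fin n → Set} {u v l} → WalkL R u v l →
             u ≡ v ⊎ Σ (Fin n) (λ w → R w v)
  walk-end stop = inj₁ refl
  walk-end (step {u} r stop) = inj₂ (u , r)
  walk-end (step {u} r (step r' w)) with walk-end (step r' w)
  ... | inj₁ refl = inj₂ (u , r)
  ... | inj₂ q = inj₂ q

  -- Shortest walks are simple: a repeated vertex would allow a shortcut.
  shortest-unique : ∀ {R : Fin n → Fin n → Set} {u v l} → WalkL R u v l →
                    (∀ l' → WalkL R u v l' → length l ≤ length l') → Unique l
  shortest-unique stop _ = [] ∷ []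
  shortest-unique (step {l = l} r w) shortest =
    All.¬Any⇒All¬ l (λ m → let (l' , w' , le) = walk-from w m in
                      ℕ.<-irrefl refl (ℕ.≤-trans (shortest l' w') le))
    ∷ shortest-unique w (λ l' w' → ℕ.≤-pred (shortest _ (step r w')))

  unique-++⁻ˡ : ∀ (xs : List (Fin n)) {ys} → Unique (xs ++ ys) → Unique xs
  unique-++⁻ˡ [] _ = []
  unique-++⁻ˡ (x ∷ xs) (x∉ ∷ u) = All.++⁻ˡ xs x∉ ∷ unique-++⁻ˡ xs u

  unique-++⁻ʳ : ∀ (xs : List (Fin n)) {ys} → Unique (xs ++ ys) → Unique ys
  unique-++⁻ʳ [] u = u
  unique-++⁻ʳ (x ∷ xs) (_ ∷ u) = unique-++⁻ʳ xs u

  unique-prefix : ∀ c {x : Fin n} {d} → Unique (c ++ x ∷ d) → Unique (c ++ x ∷ [])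
  unique-prefix c {x} {d} u =
    unique-++⁻ˡ (c ++ x ∷ []) (subst Unique (sym (++-assoc c (x ∷ []) d)) u)

  consec-++ˡ : ∀ l {m} {x y : Fin n} → Consec m x y → Consec (l ++ m) x y
  consec-++ˡ [] c = c
  consec-++ˡ (z ∷ l) c = there (consec-++ˡ l c)

  consec-++ʳ : ∀ {l m} {x y : Fin n} → Consec l x y → Consec (l ++ m) x y
  consec-++ʳ here = here
  consec-++ʳ (there c) = there (consec-++ʳ c)

  consec-split : ∀ {l} {x y : Fin n} → Consec l x y →
                 Σ (List (Fin n)) λ a → Σ (List (Fin n)) λ b → l ≡ a ++ x ∷ y ∷ b
  consec-split (here {l = l}) = [] , l , refl
  consec-split (there {z = z} c) with consec-split c
  ... | a , b , e = z ∷ a , b , cong (z ∷_) e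

  consec-compare : ∀ (a c : List (Fin n)) {x y x' y' b d} →
                   a ++ x ∷ y ∷ b ≡ c ++ x' ∷ y' ∷ d →
                   (x ≡ x' × y ≡ y') ⊎
                   (Consec (c ++ x' ∷ []) x y ⊎ Consec (a ++ x ∷ []) x' y')
  consec-compare [] [] refl = inj₁ (refl , refl)
  consec-compare [] (w ∷ []) refl = inj₂ (inj₁ here)
  consec-compare [] (w ∷ w' ∷ c) refl = inj₂ (inj₁ here)
  consec-compare (w ∷ []) [] refl = inj₂ (inj₂ here)
  consec-compare (w ∷ w' ∷ a) [] refl = inj₂ (inj₂ here)
  consec-compare (w ∷ a) (w' ∷ c) eq with consec-compare a c (proj₂ (∷-injective eq))
  ... | inj₁ e = inj₁ e
  ... | inj₂ (inj₁ k) = inj₂ (inj₁ (there k))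
  ... | inj₂ (inj₂ k) = inj₂ (inj₂ (there k))

  consec? : ∀ (l : List (Fin n)) x y → Dec (Consec l x y)
  consec? [] x y = no λ ()
  consec? (z ∷ []) x y = no λ { (there ()) }
  consec? (z ∷ z' ∷ l) x y with consec? (z' ∷ l) x y
  ... | yes c = yes (there c)
  ... | no nc with x Fin.≟ z | y Fin.≟ z'
  ...   | yes refl | yes refl = yes here
  ...   | no ne | _ = no λ { here → ne refl ; (there c) → nc c }
  ...   | yes _ | no ne = no λ { here → ne refl ; (there c) → nc c }

  consec-∉ : ∀ {l} {x y : Fin n} → All (x ≢_) l → ¬ Consec l x y
  consec-∉ (x≢ ∷ _) here = x≢ refl
  consec-∉ (_ ∷ xs≢) (there c) = consec-∉ xs≢ c

  consec-functional : ∀ {l} {x y y' : Fin n} → Unique l →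
                      Consec l x y → Consec l x y' → y ≡ y'
  consec-functional (_ ∷ _) here here = refl
  consec-functional (x∉ ∷ _) here (there c) = ⊥-elim (consec-∉ x∉ c)
  consec-functional (x∉ ∷ _) (there c) here = ⊥-elim (consec-∉ x∉ c)
  consec-functional (_ ∷ u) (there c) (there c') = consec-functional u c c'

  no-backtrack : ∀ l {x y : Fin n} {b} → ¬ Unique ((l ++ x ∷ []) ++ y ∷ x ∷ b)
  no-backtrack l {x} {y} {b} u
    with unique-++⁻ʳ l (subst Unique (++-assoc l (x ∷ []) (y ∷ x ∷ b)) u)
  ... | (_ ∷ x≢x ∷ _) ∷ _ = x≢x refl

open Paths

least-witness : ∀ {p} (Q : Fin p → Set) → (∀ k → Dec (Q k)) → ∀ i → Q i →
                Σ (Fin p) λ j → Q j × (∀ k → k Fin.< j → ¬ Q k)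
least-witness {ℕ.suc p} Q Q? i q with Q? zero
... | yes q0 = zero , q0 , λ k ()
... | no ¬q0 with i
...   | zero = ⊥-elim (¬q0 q)
...   | suc i' with least-witness (λ k → Q (suc k)) (λ k → Q? (suc k)) i' q
...     | j , qj , least = suc j , qj , below
  where
  below : ∀ k → k Fin.< suc j → ¬ Q k
  below zero _ = ¬q0
  below (suc k) (ℕ.s≤s lt) = least k lt

all-lookup : ∀ {A : Set} {D : A → Set} {L : List A} → All D L →
             (i : Fin (length L)) → D (lookup L i)
all-lookup (d ∷ _) zero = d
all-lookup (_ ∷ ds) (suc i) = all-lookup ds i

allPairs-lookup : ∀ {A : Set} {R : A → A → Set} {L : List A} → AllPairs R L →
                  ∀ i j → i Fin.< j → R (lookup L i) (lookup L j)
allPairs-lookup (r ∷ _) zero (suc j) _ = all-lookup r j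
allPairs-lookup (_ ∷ rs) (suc i) (suc j) (ℕ.s≤s lt) = allPairs-lookup rs i j lt

token-bound : ∀ {A : Set} {D : A → Set} {R : A → A → Set} {m}
              (token : ∀ {a} → D a → Fin m) →
              (∀ {a b} (da : D a) (db : D b) → token da ≡ token db → ¬ R a b) →
              (L : List A) → All D L → AllPairs R L → length L ≤ m
token-bound {m = m} token collide L ds rs with length L ℕ.≤? m
... | yes le = le
... | no nle with Fin.pigeonhole (ℕ.≰⇒> nle) (λ i → token (all-lookup ds i))
...   | i , j , i<j , same =
  ⊥-elim (collide (all-lookup ds i) (all-lookup ds j) same (allPairs-lookup rs i j i<j))

module BranchingCharge {n : ℕ} (G : Graph n) {p : ℕ} (P : Fin p → Fin n × Fin n)
  (π : (i : Fin p) → Σ (List (Fin n)) (ShortestPath (Graph.Adj G) (proj₁ (P i)) (proj₂ (P i))))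
  (tree : ∀ s → Scheme.IsTreeAt G P π s) where
  open Scheme G P π

  src : Fin p → Fin n
  src j = proj₁ (P j)

  path : Fin p → List (Fin n)
  path j = proj₁ (π j)

  path-unique : ∀ j → Unique (path j)
  path-unique j = shortest-unique (proj₁ (proj₂ (π j))) (proj₂ (proj₂ (π j)))

  tedge-sym : ∀ {s x y} → TEdge s x y → TEdge s y x
  tedge-sym (j , e , inj₁ c) = j , e , inj₂ c
  tedge-sym (j , e , inj₂ c) = j , e , inj₁ c

  path-prefix : ∀ j c {x d} → path j ≡ c ++ x ∷ d →
                SimplePath (TEdge (src j)) (src j) x (c ++ x ∷ [])
  path-prefix j c e =
    walk-prefix c (subst (WalkL _ _ _) e walk) , unique-prefix c (subst Unique e (path-unique j))
    where
    walk : WalkL (TEdge (src j)) (src j) (proj₂ (P j)) (path j)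
    walk = walk-retarget (proj₁ (proj₂ (π j))) (λ c → j , refl , inj₁ c)

  walk-in-tree : ∀ {s x l} → WalkL (TEdge s) s x l → InTree s x
  walk-in-tree w with walk-end w
  ... | inj₁ e = inj₁ (sym e)
  ... | inj₂ (w' , t) = inj₂ (w' , tedge-sym t)

  root-path-unique : ∀ s {x q q'} → SimplePath (TEdge s) s x q →
                     SimplePath (TEdge s) s x q' → q ≡ q'
  root-path-unique s {x} sp sp' with tree s s x (inj₁ refl) (walk-in-tree (proj₁ sp))
  ... | _ , _ , only = trans (only _ sp) (sym (only _ sp'))

  shared-prefix : ∀ j k c a {x d b u v} → src k ≡ src j →
                  path j ≡ c ++ x ∷ d → path k ≡ a ++ x ∷ b →
                  Consec (c ++ x ∷ []) u v → Consec (path k) u v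
  shared-prefix j k c a {x} {d} {b} {u} {v} sk ej ek cc =
    subst (λ l → Consec l u v) (sym (trans ek (sym (++-assoc a (x ∷ []) b))))
      (consec-++ʳ (subst (λ l → Consec l u v) same-prefix cc))
    where
    same-prefix : c ++ x ∷ [] ≡ a ++ x ∷ []
    same-prefix = root-path-unique (src j) (path-prefix j c ej)
      (subst (λ s → SimplePath (TEdge s) s x (a ++ x ∷ [])) sk (path-prefix k a ek))

  -- An edge of T_s oriented away from s is traversed in that direction by
  -- some pair with source s: the reverse direction would revisit x.
  oriented-on-path : ∀ {s x y} → Oriented s x y →
                     Σ (Fin p) λ j → src j ≡ s × Consec (path j) x y
  oriented-on-path {s} {x} {y} (l , w , u)
    with walk-consec w (consec-++ˡ l {x ∷ y ∷ []} here)
  ... | j , sj , inj₁ c = j , sj , c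
  ... | j , sj , inj₂ c with consec-split c
  ...   | a , b , e = ⊥-elim (no-backtrack l (subst Unique e' (path-unique j)))
    where
    prefixes : a ++ y ∷ [] ≡ (l ++ x ∷ []) ++ y ∷ []
    prefixes = trans
      (root-path-unique s (subst (λ s → SimplePath (TEdge s) s y (a ++ y ∷ [])) sj (path-prefix j a e)) (w , u))
      (sym (++-assoc l (x ∷ []) (y ∷ [])))
    e' : path j ≡ (l ++ x ∷ []) ++ y ∷ x ∷ b
    e' = trans e (cong (λ q → q ++ y ∷ x ∷ b) (∷ʳ-injectiveˡ a (l ++ x ∷ []) prefixes))

  FirstUse : Fin p → Fin n → Fin n → Set
  FirstUse j x y = Consec (path j) x y ×
                   (∀ k → k Fin.< j → src k ≡ src j → ¬ Consec (path k) x y)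

  Diverges : Fin p → Fin n → Fin n → Set
  Diverges j x y = Σ (Fin p) λ k → k Fin.< j × src k ≡ src j ×
                   Σ (Fin n) λ w → w ≢ y × Consec (path k) x w

  diverges? : ∀ j x y → Dec (Diverges j x y)
  diverges? j x y = Fin.any? (λ k → (k Fin.<? j) ×-dec (src k Fin.≟ src j) ×-dec
                      Fin.any? (λ w → ¬? (w Fin.≟ y) ×-dec consec? (path k) x w))

  first-use : ∀ {s x y} → Oriented s x y → Σ (Fin p) λ j → src j ≡ s × FirstUse j x y
  first-use {s} {x} {y} o with oriented-on-path o
  ... | j , sj , c with least-witness (λ k → src k ≡ s × Consec (path k) x y)
                          (λ k → (src k Fin.≟ s) ×-dec consec? (path k) x y) j (sj , c)
  ...   | j₀ , (sj₀ , c₀) , least = j₀ , sj₀ , c₀ , λ k lt sk c → least k lt (trans sk sj₀ , c)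

  -- Each path has at most one first-used divergent edge: if x → y came
  -- before x' → y' on π_j, the earlier path diverging at x' would share the
  -- prefix of π_j up to x', hence traverse x → y before π_j does.
  divergent-first-use-unique : ∀ j {x y x' y'} → FirstUse j x y → Diverges j x y →
                               FirstUse j x' y' → Diverges j x' y' → x ≡ x' × y ≡ y'
  divergent-first-use-unique j (c , first) (k , k<j , sk , _ , _ , ck)
                               (c' , first') (k' , k'<j , sk' , _ , _ , ck')
    with consec-split c | consec-split c'
  ... | a , b , e | a' , b' , e' with consec-compare a a' (trans (sym e) e')
  ...   | inj₁ same = same
  ...   | inj₂ (inj₁ before) with consec-split ck'
  ...     | a'' , b'' , e'' = ⊥-elim (first k' k'<j sk' (shared-prefix j k' a' a'' sk' e' e'' before))
  divergent-first-use-unique j (c , first) (k , k<j , sk , _ , _ , ck)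
                               (c' , first') (k' , k'<j , sk' , _ , _ , ck')
      | a , b , e | a' , b' , e' | inj₂ (inj₂ after) with consec-split ck
  ...     | a'' , b'' , e'' = ⊥-elim (first' k k<j sk (shared-prefix j k a a'' sk e e'' after))

  -- In each tree at most one out-edge of x is first used without divergence:
  -- of two such edges, the later-used one would diverge from the earlier.
  plain-first-use-unique : ∀ m m' {x y y'} → src m ≡ src m' →
                           FirstUse m x y → ¬ Diverges m x y →
                           FirstUse m' x y' → ¬ Diverges m' x y' → y ≡ y'
  plain-first-use-unique m m' {x} {y} {y'} sm (c , _) plain (c' , _) plain'
    with y Fin.≟ y'
  ... | yes e = e
  ... | no y≢y' with Fin.<-cmp m m'
  ...   | tri< m<m' _ _ = ⊥-elim (plain' (m , m<m' , sm , y , y≢y' , c))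
  ...   | tri≈ _ refl _ = ⊥-elim (y≢y' (consec-functional (path-unique m) c c'))
  ...   | tri> _ _ m'<m = ⊥-elim (plain (m' , m'<m , sym sm , y' , (λ e → y≢y' (sym e)) , c'))

  -- Tokens: inj₁ j charges the divergent first-used edge of π_j; inj₂ j
  -- charges, for that edge x → z, the plain first-used out-edge x → y of x.
  Token : Set
  Token = Fin p ⊎ Fin p

  Charged : Token → Fin n → Fin n → Set
  Charged (inj₁ j) x y = FirstUse j x y × Diverges j x y
  Charged (inj₂ j) x y = Σ (Fin n) λ z → (FirstUse j x z × Diverges j x z) ×
                         Σ (Fin p) λ m → src m ≡ src j × FirstUse m x y × ¬ Diverges m x y

  charged-unique : ∀ t {x y x' y'} → Charged t x y → Charged t x' y' → x ≡ x' × y ≡ y'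
  charged-unique (inj₁ j) (f , d) (f' , d') = divergent-first-use-unique j f d f' d'
  charged-unique (inj₂ j) (z , (f , d) , m , sm , g , plain) (z' , (f' , d') , m' , sm' , g' , plain')
    with divergent-first-use-unique j f d f' d'
  ... | refl , refl = refl , plain-first-use-unique m m' (trans sm (sym sm')) g plain g' plain'

  charge : ∀ {s x y} → BranchingEdge s x y → Σ Token λ t → Charged t x y
  charge {s} {x} {y} (o , branching) with first-use o
  ... | j₀ , sj₀ , F₀ with diverges? j₀ x y
  ...   | yes d = inj₁ j₀ , F₀ , d
  ...   | no plain = via-sibling branching
    where
    -- x → y is plain, so the first use of another out-edge x → z comes later and diverges.
    from-sibling : ∀ {z} → z ≢ y → Oriented s x z → Σ Token λ t → Charged t x y
    from-sibling {z} z≢y oz with first-use oz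
    ... | j₁ , sj₁ , F₁ with Fin.<-cmp j₀ j₁
    ...   | tri< j₀<j₁ _ _ = inj₂ j₁ , z ,
              (F₁ , (j₀ , j₀<j₁ , trans sj₀ (sym sj₁) , y , (λ e → z≢y (sym e)) , proj₁ F₀)) ,
              j₀ , trans sj₀ (sym sj₁) , F₀ , plain
    ...   | tri≈ _ refl _ = ⊥-elim (z≢y (sym (consec-functional (path-unique j₀) (proj₁ F₀) (proj₁ F₁))))
    ...   | tri> _ _ j₁<j₀ = ⊥-elim (plain (j₁ , j₁<j₀ , trans sj₁ (sym sj₀) , z , z≢y , proj₁ F₁))
    via-sibling : Branching s x → Σ Token λ t → Charged t x y
    via-sibling (y₁ , y₂ , y₁≢y₂ , o₁ , o₂) with y₁ Fin.≟ y
    ... | yes refl = from-sibling (λ e → y₁≢y₂ (sym e)) o₂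
    ... | no y₁≢y = from-sibling y₁≢y o₁

  ChargedEdge : Token → Fin n × Fin n → Set
  ChargedEdge t e = Σ (Fin n) λ x → Σ (Fin n) λ y → (e ≡ (x , y) ⊎ e ≡ (y , x)) × Charged t x y

  charge-edge : ∀ {e} → InBranchUnion e → Σ Token λ t → ChargedEdge t e
  charge-edge {x , y} (s , inj₁ be) with charge be
  ... | t , ch = t , x , y , inj₁ refl , ch
  charge-edge {x , y} (s , inj₂ be) with charge be
  ... | t , ch = t , y , x , inj₂ refl , ch

  orientations-same : ∀ {e e' : Fin n × Fin n} {x y} →
                      e ≡ (x , y) ⊎ e ≡ (y , x) → e' ≡ (x , y) ⊎ e' ≡ (y , x) → SameEdge e e'
  orientations-same (inj₁ refl) (inj₁ refl) = inj₁ (refl , refl)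
  orientations-same (inj₁ refl) (inj₂ refl) = inj₂ (refl , refl)
  orientations-same (inj₂ refl) (inj₁ refl) = inj₂ (refl , refl)
  orientations-same (inj₂ refl) (inj₂ refl) = inj₁ (refl , refl)

  charged-edge-unique : ∀ {t e e'} → ChargedEdge t e → ChargedEdge t e' → SameEdge e e'
  charged-edge-unique {t} (x , y , o , ch) (x' , y' , o' , ch') with charged-unique t ch ch'
  ... | refl , refl = orientations-same o o'

  encode : Token → Fin (p ℕ.+ p)
  encode = Fin.join p p

  encode-injective : ∀ {t t'} → encode t ≡ encode t' → t ≡ t'
  encode-injective {t} {t'} eq =
    trans (sym (Fin.splitAt-join p p t)) (trans (cong (Fin.splitAt p) eq) (Fin.splitAt-join p p t'))

  branching-edges-bound : (L : List (Fin n × Fin n)) → All InBranchUnion L →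
                          AllPairs (λ e e' → ¬ SameEdge e e') L → length L ≤ 2 * p
  branching-edges-bound L inUnion distinct =
    ℕ.≤-trans (token-bound (λ b → encode (proj₁ (charge-edge b))) collide L inUnion distinct)
              (ℕ.≤-reflexive (cong (p ℕ.+_) (sym (ℕ.+-identityʳ p))))
    where
    collide : ∀ {e e'} (b : InBranchUnion e) (b' : InBranchUnion e') →
              encode (proj₁ (charge-edge b)) ≡ encode (proj₁ (charge-edge b')) → ¬ ¬ SameEdge e e'
    collide {e' = e'} b b' same different = different (charged-edge-unique
      (proj₂ (charge-edge b))
      (subst (λ t → ChargedEdge t e') (sym (encode-injective same)) (proj₂ (charge-edge b'))))

-- C = 2, by the charging bound; it needs only the tree condition of laziness.
claim6 : ∃ λ (C : ℕ) →
    ∀ (n : ℕ) (G : Graph n) (p : ℕ) (P : Fin p → Fin n × Fin n) →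
    Injective _≡_ _≡_ P →
    (π : (i : Fin p) → Σ (List (Fin n)) (ShortestPath (Graph.Adj G) (proj₁ (P i)) (proj₂ (P i)))) →
    Scheme.Lazy G P π →
    (L : List (Fin n × Fin n)) →
    All (Scheme.InBranchUnion G P π) L →
    AllPairs (λ e e' → ¬ SameEdge e e') L →
    length L ≤ C * p
claim6 = 2 , λ n G p P _ π lazy → BranchingCharge.branching-edges-bound G P π (proj₁ lazy)
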